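{- Let $m,n\ge3$ be integers, let $L\subset\mathbb{Z}^2$ be the sublattice generated by $(1,2)$ and $(2,-1)$, and let $\rho:\mathbb{Z}^2\to\mathbb{Z}_m\times\mathbb{Z}_n$ be the reduction map $\rho(i,j)=(i\bmod m,j\bmod n)$. The graph $C_m\times C_n$ has a partition of its vertex set into five 1-perfect codes $S^0=\rho(L),S^1,\dots,S^4$, each of which is a translate of $\rho(L)$, if and only if $m$ and $n$ are both multiples of $5$. In that case each $S^i$ has cardinality $mn/5$, and no $S^i$ is the image under the side-identification map $\pi$ of a 1-perfect code of the rectangular grid graph $\Gamma$.
   Context: $C_m\times C_n$ is the graph with vertex set $\mathbb{Z}_m\times\mathbb{Z}_n$, two vertices adjacent iff they agree in one coordinate and differ by $\pm1$ in the other. A 1-perfect code in a graph $G$ is a vertex set $S$ such that no two vertices of $S$ are adjacent and every vertex not in $S$ is adjacent to exactly one vertex of $S$. $\Gamma$ denotes the rectangular grid graph with vertex set $\{0,\dots,m\}\times\{0,\dots,n\}$ and edges between points at Euclidean distance $1$; $\pi:\Gamma\to C_m\times C_n$, $\pi(i,j)=(i\bmod m,j\bmod n)$, identifies opposite sides of $\Gamma$. -}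

module Defs where

open import Level using (Level; _⊔_) renaming (suc to lsuc)
open import Data.Nat as ℕ using (ℕ; NonZero)
open import Data.Integer as ℤ using (ℤ; +_; -[1+_]; _+_; _*_; -_)
open import Data.Integer.DivMod using (_%ℕ_; n%ℕd<d)
open import Data.Fin using (Fin; fromℕ<; toℕ) renaming (zero to fzero)
open import Data.Product using (Σ; ∃; _×_; _,_)
open import Data.Sum using (_⊎_)
open import Data.List using (List; length)
open import Data.List.Membership.Propositional using (_∈_)
open import Data.List.Relation.Unary.Unique.Propositional using (Unique)
open import Function.Bundles using (_⇔_)
open import Relation.Binary.PropositionalEquality using (_≡_)
open import Relation.Nullary using (¬_)

Pred : Set → Set₁
Pred V = V → Set

PerfectCode : {V : Set} → (V → V → Set) → Pred V → Set
PerfectCode {V} adj S =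
  (∀ u v → S u → S v → ¬ adj u v) ×
  (∀ v → ¬ S v →
     Σ V λ u → (S u × adj v u) × (∀ u′ → S u′ → adj v u′ → u′ ≡ u))

_≐_ : {V : Set} → Pred V → Pred V → Set
P ≐ Q = ∀ v → P v ⇔ Q v

HasSize : {V : Set} → Pred V → ℕ → Set
HasSize {V} P k =
  Σ (List V) λ xs → Unique xs × (∀ v → P v ⇔ (v ∈ xs)) × length xs ≡ k

ℤ² : Set
ℤ² = ℤ × ℤ

_+²_ : ℤ² → ℤ² → ℤ²
(a , b) +² (c , d) = (a + c , b + d)

InL : Pred ℤ²
InL x = Σ ℤ λ a → Σ ℤ λ b →
  x ≡ (a * + 1 + b * + 2 , a * + 2 + b * (- + 1))

-- ℤ_m represented by Fin m
Vtx : ℕ → ℕ → Set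
Vtx m n = Fin m × Fin n

reduce : (m : ℕ) → .{{NonZero m}} → ℤ → Fin m
reduce m z = fromℕ< (n%ℕd<d z m)

ρ : (m n : ℕ) → .{{NonZero m}} → .{{NonZero n}} → ℤ² → Vtx m n
ρ m n (i , j) = (reduce m i , reduce n j)

lift : {m n : ℕ} → Vtx m n → ℤ²
lift (i , j) = (+ toℕ i , + toℕ j)

Unit : Pred ℤ²
Unit e = (e ≡ (+ 1 , + 0)) ⊎ (e ≡ (- + 1 , + 0)) ⊎
         (e ≡ (+ 0 , + 1)) ⊎ (e ≡ (+ 0 , - + 1))

TorusAdj : (m n : ℕ) → .{{NonZero m}} → .{{NonZero n}} → Vtx m n → Vtx m n → Set
TorusAdj m n u v = Σ ℤ² λ e → Unit e × ρ m n (lift u +² e) ≡ v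

TranslateρL : (m n : ℕ) → .{{NonZero m}} → .{{NonZero n}} → ℤ² → Pred (Vtx m n)
TranslateρL m n t v = Σ ℤ² λ x → InL x × ρ m n (x +² t) ≡ v

ρL : (m n : ℕ) → .{{NonZero m}} → .{{NonZero n}} → Pred (Vtx m n)
ρL m n v = Σ ℤ² λ x → InL x × ρ m n x ≡ v

IsTranslatePartition : (m n : ℕ) → .{{NonZero m}} → .{{NonZero n}} →
                       (Fin 5 → Pred (Vtx m n)) → Set
IsTranslatePartition m n S =
  (∀ v → Σ (Fin 5) λ i → S i v) ×
  (∀ v i j → S i v → S j v → i ≡ j) ×
  (∀ i → PerfectCode (TorusAdj m n) (S i)) ×
  (S fzero ≐ ρL m n) ×
  (∀ i → Σ ℤ² λ t → S i ≐ TranslateρL m n t)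

ΓVtx : ℕ → ℕ → Set
ΓVtx m n = Fin (ℕ.suc m) × Fin (ℕ.suc n)

ΓAdj : {m n : ℕ} → ΓVtx m n → ΓVtx m n → Set
ΓAdj (a , b) (c , d) =
  (toℕ a ≡ toℕ c × (ℕ.suc (toℕ b) ≡ toℕ d ⊎ ℕ.suc (toℕ d) ≡ toℕ b)) ⊎
  (toℕ b ≡ toℕ d × (ℕ.suc (toℕ a) ≡ toℕ c ⊎ ℕ.suc (toℕ c) ≡ toℕ a))

π : (m n : ℕ) → .{{NonZero m}} → .{{NonZero n}} → ΓVtx m n → Vtx m n
π m n x = ρ m n (lift x)

πImage : (m n : ℕ) → .{{NonZero m}} → .{{NonZero n}} → Pred (ΓVtx m n) → Pred (Vtx m n)
πImage m n T v = Σ (ΓVtx m n) λ x → T x × π m n x ≡ v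

module Submission where

-- Colour a lattice point by φ(a, b) = a + 2b.  The lattice L generated by (1,2) and (2,-1)
-- is exactly the set of points of colour 0 mod 5, so its translates are the five colour
-- classes mod 5, and the four unit steps have colours 1, -1, 2, -2: non-zero and pairwise
-- distinct mod 5.
--   If 5 ∣ m and 5 ∣ n the colour mod 5 is well defined on C_m × C_n.  Every colour class
-- is then a 1-perfect code (from each vertex exactly one unit step reaches a given class),
-- the classes of the points (i, 0), i < 5, form the required partition, and each class has
-- mn/5 vertices (in every row it occupies one residue of columns mod 5).  Conversely, if
-- 5 ∤ m then 5 ∣ 1 + k·m for some k, so (1 + k·m, 0) ∈ L reduces to the neighbour ρ(1,0) of
-- ρ(0,0) and ρ(L) is not independent; likewise for n.  Finally, a 1-perfect code T of Γ
-- with π(T) a colour class c would have to dominate the bottom-row vertex w whose missing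
-- lower neighbour has colour c, but w and its three Γ-neighbours all have other colours.

open import Defs
open import Data.Nat as ℕ using (ℕ; NonZero; suc; s≤s; z≤n; _<_; _≤_; _%_; _/_)
import Data.Nat.Properties as ℕ
open import Data.Nat.Divisibility using (_∣_; divides; _∣?_; m%n≡0⇒n∣m; ∣⇒≤; >⇒∤)
open import Data.Nat.DivMod using (m<n⇒m%n≡m; [m+kn]%n≡m%n; m%n<n; m≡m%n+[m/n]*n; m<n*o⇒m/o<n; m*n/n≡m)
open import Data.Nat.Tactic.RingSolver using () renaming (solve-∀ to ℕ-solve-∀)
open import Data.Integer using (ℤ; +_; 0ℤ; _+_; _*_; _-_; -_; _⊖_)
import Data.Integer as ℤ using (∣_∣)
import Data.Integer.Properties as ℤ
open import Data.Integer.Divisibility.Signed using (divides; ∣⇒∣ᵤ; ∣ᵤ⇒∣; ∣m∣n⇒∣m+n; ∣m⇒∣-m; ∣n⇒∣m*n)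
  renaming (_∣_ to _∣ℤ_)
open import Data.Integer.DivMod using (_%ℕ_; _/ℕ_; n%ℕd<d; a≡a%ℕn+[a/ℕn]*n)
open import Data.Integer.Tactic.RingSolver using (solve-∀)
open import Data.Fin using (Fin; toℕ; fromℕ<; remQuot; combine) renaming (zero to fzero)
import Data.Fin.Properties as Fin
open import Data.List using (tabulate)
open import Data.List.Properties using (length-tabulate)
open import Data.List.Membership.Propositional using (_∈_)
open import Data.List.Membership.Propositional.Properties using (∈-tabulate⁺; ∈-tabulate⁻)
import Data.List.Relation.Unary.Unique.Propositional.Properties as Unique
open import Data.Product using (Σ; _×_; _,_; proj₁; proj₂; uncurry)
open import Data.Sum using (inj₁; inj₂)
open import Function using (_∘_)
open import Function.Bundles using (_⇔_; mk⇔; Equivalence)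
open import Function.Properties.Equivalence using () renaming (refl to ⇔-refl; sym to ⇔-sym; trans to ⇔-trans)
open import Relation.Binary.Bundles using (Setoid)
open import Relation.Binary.PropositionalEquality
import Relation.Binary.Reasoning.Setoid as SetoidReasoning
open import Relation.Nullary using (¬_; contradiction)
open import Relation.Nullary.Decidable using (decidable-stable)

module Congruence (d : ℕ) .{{_ : NonZero d}} where

  infix 4 _≋_
  record _≋_ (a b : ℤ) : Set where
    constructor ≋-intro
    field divides-difference : + d ∣ℤ a - b

  ≋-via : ∀ {a b z} → a - b ≡ z → + d ∣ℤ z → a ≋ b
  ≋-via refl d∣z = ≋-intro d∣z

  ≋-reflexive : ∀ {a b} → a ≡ b → a ≋ b
  ≋-reflexive {a} refl = ≋-intro (divides 0ℤ (ℤ.+-inverseʳ a))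

  ≋-refl : ∀ {a} → a ≋ a
  ≋-refl = ≋-reflexive refl

  ≋-sym : ∀ {a b} → a ≋ b → b ≋ a
  ≋-sym {a} {b} (≋-intro p) = ≋-via (flip a b) (∣m⇒∣-m p)
    where flip : ∀ a b → b - a ≡ - (a - b)
          flip = solve-∀

  ≋-trans : ∀ {a b c} → a ≋ b → b ≋ c → a ≋ c
  ≋-trans {a} {b} {c} (≋-intro p) (≋-intro q) = ≋-via (split a b c) (∣m∣n⇒∣m+n p q)
    where split : ∀ a b c → a - c ≡ (a - b) + (b - c)
          split = solve-∀

  ≋-setoid : Setoid _ _
  ≋-setoid = record { Carrier = ℤ ; _≈_ = _≋_
                    ; isEquivalence = record { refl = ≋-refl ; sym = ≋-sym ; trans = ≋-trans } }

  module ≋-Reasoning = SetoidReasoning ≋-setoid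

  +-cong : ∀ {a a′ b b′} → a ≋ a′ → b ≋ b′ → a + b ≋ a′ + b′
  +-cong {a} {a′} {b} {b′} (≋-intro p) (≋-intro q) = ≋-via (split a a′ b b′) (∣m∣n⇒∣m+n p q)
    where split : ∀ a a′ b b′ → (a + b) - (a′ + b′) ≡ (a - a′) + (b - b′)
          split = solve-∀

  +-congˡ : ∀ a {b b′} → b ≋ b′ → a + b ≋ a + b′
  +-congˡ a = +-cong (≋-refl {a})

  +-congʳ : ∀ {a a′} b → a ≋ a′ → a + b ≋ a′ + b
  +-congʳ b a≋a′ = +-cong a≋a′ (≋-refl {b})

  *-congˡ : ∀ k {a a′} → a ≋ a′ → k * a ≋ k * a′
  *-congˡ k {a} {a′} (≋-intro p) = ≋-via (factor k a a′) (∣n⇒∣m*n k p)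
    where factor : ∀ k a a′ → k * a - k * a′ ≡ k * (a - a′)
          factor = solve-∀

  +-cancelˡ : ∀ a {b b′} → a + b ≋ a + b′ → b ≋ b′
  +-cancelˡ a {b} {b′} (≋-intro p) = ≋-via (sym (cancel a b b′)) p
    where cancel : ∀ a b b′ → (a + b) - (a + b′) ≡ b - b′
          cancel = solve-∀

  ≋-sub : ∀ {a b c} → a + b ≋ c → a ≋ c - b
  ≋-sub {a} {b} h = ≋-trans (≋-reflexive (cancel a b)) (+-congʳ (- b) h)
    where cancel : ∀ a b → a ≡ (a + b) - b
          cancel = solve-∀

  +-multiple : ∀ {a z} → + d ∣ℤ z → a + z ≋ a
  +-multiple {a} {z} p = ≋-via (cancel a z) p
    where cancel : ∀ a z → (a + z) - a ≡ z
          cancel = solve-∀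

  +-multipleℕ : ∀ x k → + (x ℕ.+ k ℕ.* d) ≋ + x
  +-multipleℕ x k = ≋-trans (≋-reflexive (trans (ℤ.pos-+ x (k ℕ.* d)) (cong (_+_ (+ x)) (ℤ.pos-* k d))))
                            (+-multiple (divides (+ k) refl))

  residue : ℤ → ℕ
  residue z = z %ℕ d

  ≋-residue : ∀ z → z ≋ + residue z
  ≋-residue z = ≋-via (trans (cong (_- + residue z) (a≡a%ℕn+[a/ℕn]*n z d)) (cancel (+ residue z) (z /ℕ d) (+ d)))
                      (divides (z /ℕ d) refl)
    where cancel : ∀ r q d → (r + q * d) - r ≡ q * d
          cancel = solve-∀

  small-multiple : ∀ z → ℤ.∣ z ∣ < d → + d ∣ℤ z → z ≡ 0ℤ
  small-multiple z bound p with ℤ.∣ z ∣ in ∣z∣≡ | ∣⇒∣ᵤ p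
  ... | 0     | _     = ℤ.∣i∣≡0⇒i≡0 ∣z∣≡
  ... | suc _ | d∣∣z∣ = contradiction d∣∣z∣ (>⇒∤ bound)

  ∣⊖∣<d : ∀ {x y} → x < d → y < d → ℤ.∣ x ⊖ y ∣ < d
  ∣⊖∣<d {x} {y} x<d y<d with ℕ.≤-total x y
  ... | inj₁ x≤y = subst (_< d) (sym (ℤ.∣⊖∣-≤ x≤y)) (ℕ.≤-<-trans (ℕ.m∸n≤m y x) y<d)
  ... | inj₂ y≤x = subst (_< d) (trans (sym (ℤ.∣⊖∣-≤ y≤x)) (ℤ.∣m⊖n∣≡∣n⊖m∣ y x)) (ℕ.≤-<-trans (ℕ.m∸n≤m x y) x<d)

  ≋-below-d : ∀ {x y} → x < d → y < d → + x ≋ + y → x ≡ y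
  ≋-below-d {x} {y} x<d y<d (≋-intro p) = ℤ.+-injective (ℤ.i-j≡0⇒i≡j (+ x) (+ y)
    (small-multiple (+ x - + y) (subst (λ z → ℤ.∣ z ∣ < d) (sym (ℤ.m-n≡m⊖n x y)) (∣⊖∣<d x<d y<d)) p))

  residue-cong : ∀ {a b} → a ≋ b → residue a ≡ residue b
  residue-cong {a} {b} a≋b = ≋-below-d (n%ℕd<d a d) (n%ℕd<d b d)
    (≋-trans (≋-sym (≋-residue a)) (≋-trans a≋b (≋-residue b)))

  residue-injective : ∀ {a b} → residue a ≡ residue b → a ≋ b
  residue-injective {a} {b} eq =
    ≋-trans (≋-residue a) (≋-trans (≋-reflexive (cong +_ eq)) (≋-sym (≋-residue b)))

open Congruence 5

φ : ℤ² → ℤ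
φ (a , b) = a + + 2 * b

φ-+ : ∀ x y → φ (x +² y) ≡ φ x + φ y
φ-+ (a , b) (c , d) = regroup a b c d
  where regroup : ∀ a b c d → (a + c) + + 2 * (b + d) ≡ (a + + 2 * b) + (c + + 2 * d)
        regroup = solve-∀

+²-identityˡ : ∀ x → (0ℤ , 0ℤ) +² x ≡ x
+²-identityˡ (a , b) = cong₂ _,_ (ℤ.+-identityˡ a) (ℤ.+-identityˡ b)

+²-identityʳ : ∀ x → x +² (0ℤ , 0ℤ) ≡ x
+²-identityʳ (a , b) = cong₂ _,_ (ℤ.+-identityʳ a) (ℤ.+-identityʳ b)

-- L is the kernel of the colour mod 5: φ(a(1,2) + b(2,-1)) = 5a, and conversely a point
-- (x₁, x₂) with x₁ + 2x₂ = 5q is q(1,2) + (2q − x₂)(2,-1).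
InL⇔φ≋0 : ∀ x → InL x ⇔ (φ x ≋ 0ℤ)
InL⇔φ≋0 x = mk⇔ to from
  where
  to : ∀ {x} → InL x → φ x ≋ 0ℤ
  to (a , b , refl) = ≋-via (five a b) (divides a refl)
    where five : ∀ a b → (a * + 1 + b * + 2) + + 2 * (a * + 2 + b * - + 1) - 0ℤ ≡ a * + 5
          five = solve-∀
  from : ∀ {x} → φ x ≋ 0ℤ → InL x
  from {x₁ , x₂} (≋-intro (divides q φx≡5q)) = q , + 2 * q - x₂ , cong₂ _,_ first (second q x₂)
    where
    open ≡-Reasoning
    first : x₁ ≡ q * + 1 + (+ 2 * q - x₂) * + 2
    first = begin
      x₁                                    ≡⟨ isolate x₁ x₂ ⟩
      ((x₁ + + 2 * x₂) - 0ℤ) - + 2 * x₂     ≡⟨ cong (_- + 2 * x₂) φx≡5q ⟩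
      q * + 5 - + 2 * x₂                    ≡⟨ regroup q x₂ ⟩
      q * + 1 + (+ 2 * q - x₂) * + 2        ∎
      where isolate : ∀ x₁ x₂ → x₁ ≡ ((x₁ + + 2 * x₂) - 0ℤ) - + 2 * x₂
            isolate = solve-∀
            regroup : ∀ q x₂ → q * + 5 - + 2 * x₂ ≡ q * + 1 + (+ 2 * q - x₂) * + 2
            regroup = solve-∀
    second : ∀ q x₂ → x₂ ≡ q * + 2 + (+ 2 * q - x₂) * - + 1
    second = solve-∀

-- The unit step whose colour has residue r ∈ {1, 2, 3, 4} (colours 1, 2, −2, −1).
direction : ℕ → ℤ²
direction 1 = + 1 , 0ℤ
direction 2 = 0ℤ , + 1
direction 3 = 0ℤ , - + 1
direction 4 = - + 1 , 0ℤ
direction _ = 0ℤ , 0ℤ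

direction-residue : ∀ {e} → Unit e → direction (residue (φ e)) ≡ e
direction-residue (inj₁ refl)               = refl
direction-residue (inj₂ (inj₁ refl))        = refl
direction-residue (inj₂ (inj₂ (inj₁ refl))) = refl
direction-residue (inj₂ (inj₂ (inj₂ refl))) = refl

unit-injective : ∀ {e e′} → Unit e → Unit e′ → φ e ≋ φ e′ → e ≡ e′
unit-injective u u′ φe≋φe′ =
  trans (sym (direction-residue u)) (trans (cong direction (residue-cong φe≋φe′)) (direction-residue u′))

-- a unit step changes the colour: otherwise it would be direction 0 = (0, 0)
unit-colour-nonzero : ∀ {e} → Unit e → ¬ (φ e ≋ 0ℤ)
unit-colour-nonzero u φe≋0 =
  unit-nonzero u (trans (sym (direction-residue u)) (cong direction (residue-cong φe≋0)))
  where
  unit-nonzero : ∀ {e} → Unit e → ¬ (e ≡ (0ℤ , 0ℤ))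
  unit-nonzero (inj₁ refl)               ()
  unit-nonzero (inj₂ (inj₁ refl))        ()
  unit-nonzero (inj₂ (inj₂ (inj₁ refl))) ()
  unit-nonzero (inj₂ (inj₂ (inj₂ refl))) ()

direction-unit : ∀ r → 0 < r → r < 5 → Unit (direction r) × φ (direction r) ≋ + r
direction-unit 0 () _
direction-unit 1 _ _ = inj₁ refl , residue-injective refl
direction-unit 2 _ _ = inj₂ (inj₂ (inj₁ refl)) , residue-injective refl
direction-unit 3 _ _ = inj₂ (inj₂ (inj₂ refl)) , residue-injective refl
direction-unit 4 _ _ = inj₂ (inj₁ refl) , residue-injective refl
direction-unit (suc (suc (suc (suc (suc _))))) _ (s≤s (s≤s (s≤s (s≤s (s≤s ())))))

PerfectCode-resp-≐ : ∀ {V : Set} {adj : V → V → Set} {P Q : Pred V} →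
                     P ≐ Q → PerfectCode adj Q → PerfectCode adj P
PerfectCode-resp-≐ {P = P} {Q} P≐Q (independent , dominating) =
  (λ u v pu pv → independent u v (to u pu) (to v pv)) ,
  (λ v ¬pv → let (u , (qu , adj) , unique) = dominating v (λ qv → ¬pv (from v qv))
             in u , (from u qu , adj) , λ u′ pu′ → unique u′ (to u′ pu′))
  where
  to : ∀ v → P v → Q v
  to v = Equivalence.to (P≐Q v)
  from : ∀ v → Q v → P v
  from v = Equivalence.from (P≐Q v)

HasSize-resp-≐ : ∀ {V : Set} {P Q : Pred V} {k} → P ≐ Q → HasSize Q k → HasSize P k
HasSize-resp-≐ P≐Q (xs , unique , Q≐xs , length≡k) =
  xs , unique , (λ v → ⇔-trans (P≐Q v) (Q≐xs v)) , length≡k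

image-size : ∀ {V : Set} {P : Pred V} {k} (f : Fin k → V) → (∀ {i j} → f i ≡ f j → i ≡ j) →
             (∀ v → P v ⇔ (Σ (Fin k) λ i → f i ≡ v)) → HasSize P k
image-size f f-injective P≐image =
  tabulate f , Unique.tabulate⁺ f-injective ,
  (λ v → mk⇔ (λ pv → let (i , fi≡v) = Equivalence.to (P≐image v) pv
                     in subst (_∈ tabulate f) fi≡v (∈-tabulate⁺ i))
             (λ v∈ → let (i , v≡fi) = ∈-tabulate⁻ v∈
                     in Equivalence.from (P≐image v) (i , sym v≡fi))) ,
  length-tabulate f

ColourClass : (m n : ℕ) → ℤ → Pred (Vtx m n)
ColourClass _ _ c v = φ (lift v) ≋ c

-- Counting a colour class of the vertex set with a·5 columns and n rows: in row j its
-- vertices are exactly the columns (c − 2j mod 5) + 5k with k < a.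
module ColourClassCount (a n : ℕ) (c : ℤ) where

  column : Fin n → ℕ
  column j = residue (c - + 2 * + toℕ j)

  column-bound : ∀ (k : Fin a) j → column j ℕ.+ toℕ k ℕ.* 5 < a ℕ.* 5
  column-bound k j = ℕ.≤-trans (ℕ.+-monoˡ-< (toℕ k ℕ.* 5) (n%ℕd<d (c - + 2 * + toℕ j) 5))
                               (ℕ.*-monoˡ-≤ 5 (Fin.toℕ<n k))

  point : Fin a × Fin n → Vtx (a ℕ.* 5) n
  point (k , j) = fromℕ< (column-bound k j) , j

  point-injective : ∀ {p q} → point p ≡ point q → p ≡ q
  point-injective {k , j} {k′ , j′} eq with cong proj₂ eq
  ... | refl = cong (_, j) (Fin.toℕ-injective (ℕ.*-cancelʳ-≡ (toℕ k) (toℕ k′) 5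
                 (ℕ.+-cancelˡ-≡ (column j) _ _ (begin
                   column j ℕ.+ toℕ k ℕ.* 5      ≡⟨ Fin.toℕ-fromℕ< (column-bound k j) ⟨
                   toℕ (proj₁ (point (k , j)))   ≡⟨ cong (toℕ ∘ proj₁) eq ⟩
                   toℕ (proj₁ (point (k′ , j)))  ≡⟨ Fin.toℕ-fromℕ< (column-bound k′ j) ⟩
                   column j ℕ.+ toℕ k′ ℕ.* 5     ∎))))
    where open ≡-Reasoning

  point-colour : ∀ p → ColourClass (a ℕ.* 5) n c (point p)
  point-colour (k , j) = begin
    + toℕ (fromℕ< (column-bound k j)) + + 2 * + toℕ j  ≡⟨ cong (λ x → + x + + 2 * + toℕ j) (Fin.toℕ-fromℕ< _) ⟩
    + (column j ℕ.+ toℕ k ℕ.* 5) + + 2 * + toℕ j       ≈⟨ +-congʳ (+ 2 * + toℕ j) (+-multipleℕ (column j) (toℕ k)) ⟩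
    + column j + + 2 * + toℕ j                         ≈⟨ +-congʳ (+ 2 * + toℕ j) (≋-sym (≋-residue (c - + 2 * + toℕ j))) ⟩
    (c - + 2 * + toℕ j) + + 2 * + toℕ j                ≡⟨ cancel c (+ 2 * + toℕ j) ⟩
    c                                                  ∎
    where open ≋-Reasoning
          cancel : ∀ a b → (a - b) + b ≡ a
          cancel = solve-∀

  point-surjective : ∀ v → ColourClass (a ℕ.* 5) n c v → Σ (Fin a × Fin n) λ p → point p ≡ v
  point-surjective (x , j) x∈c = (k , j) , cong (_, j) (Fin.toℕ-injective (begin
    toℕ (fromℕ< (column-bound k j))  ≡⟨ Fin.toℕ-fromℕ< _ ⟩
    column j ℕ.+ toℕ k ℕ.* 5         ≡⟨ cong₂ (λ r q → r ℕ.+ q ℕ.* 5) (residue-cong (≋-sub {+ toℕ x} x∈c))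
                                                                      (sym (Fin.toℕ-fromℕ< x/5<a)) ⟨
    toℕ x % 5 ℕ.+ toℕ x / 5 ℕ.* 5    ≡⟨ m≡m%n+[m/n]*n (toℕ x) 5 ⟨
    toℕ x                            ∎))
    where open ≡-Reasoning
          x/5<a : toℕ x / 5 < a
          x/5<a = m<n*o⇒m/o<n (Fin.toℕ<n x)
          k = fromℕ< x/5<a

  index : Fin (a ℕ.* n) → Vtx (a ℕ.* 5) n
  index = point ∘ remQuot {a} n

  index-injective : ∀ {i i′} → index i ≡ index i′ → i ≡ i′
  index-injective {i} {i′} eq = begin
    i                                   ≡⟨ Fin.combine-remQuot {a} n i ⟨
    uncurry combine (remQuot {a} n i)   ≡⟨ cong (uncurry combine) (point-injective {remQuot {a} n i} {remQuot {a} n i′} eq) ⟩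
    uncurry combine (remQuot {a} n i′)  ≡⟨ Fin.combine-remQuot {a} n i′ ⟩
    i′                                  ∎
    where open ≡-Reasoning

  size : HasSize (ColourClass (a ℕ.* 5) n c) (a ℕ.* n)
  size = image-size index index-injective λ v →
    mk⇔ (λ v∈c → let ((k , j) , eq) = point-surjective v v∈c
                 in combine k j , trans (cong point (Fin.remQuot-combine k j)) eq)
        (λ (i , eq) → subst (ColourClass (a ℕ.* 5) n c) eq (point-colour (remQuot {a} n i)))

colour-class-size : ∀ m n → 5 ∣ m → ∀ c → HasSize (ColourClass m n c) (m ℕ.* n / 5)
colour-class-size .(a ℕ.* 5) n (divides a refl) c =
  subst (HasSize (ColourClass (a ℕ.* 5) n c)) (sym count) (ColourClassCount.size a n c)
  where count : a ℕ.* 5 ℕ.* n / 5 ≡ a ℕ.* n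
        count = trans (cong (_/ 5) (swap a n)) (m*n/n≡m (a ℕ.* n) 5)
          where swap : ∀ a n → a ℕ.* 5 ℕ.* n ≡ a ℕ.* n ℕ.* 5
                swap = ℕ-solve-∀

same-coordinate : ∀ {x y} → x ≡ y → + y ≡ + x + 0ℤ
same-coordinate refl = sym (ℤ.+-identityʳ _)

next-coordinate : ∀ {x y} → suc x ≡ y → + y ≡ + x + + 1
next-coordinate {x} refl = cong +_ (ℕ.+-comm 1 x)

previous-coordinate : ∀ {x y} → suc y ≡ x → + y ≡ + x + - + 1
previous-coordinate refl = refl

grid-step : ∀ {m n} (w u : ΓVtx m n) → ΓAdj w u → Σ ℤ² λ e → Unit e × lift u ≡ lift w +² e
grid-step _ _ (inj₁ (same , inj₁ next)) =
  (0ℤ , + 1) , inj₂ (inj₂ (inj₁ refl)) , cong₂ _,_ (same-coordinate same) (next-coordinate next)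
grid-step _ _ (inj₁ (same , inj₂ previous)) =
  (0ℤ , - + 1) , inj₂ (inj₂ (inj₂ refl)) , cong₂ _,_ (same-coordinate same) (previous-coordinate previous)
grid-step _ _ (inj₂ (same , inj₁ next)) =
  (+ 1 , 0ℤ) , inj₁ refl , cong₂ _,_ (next-coordinate next) (same-coordinate same)
grid-step _ _ (inj₂ (same , inj₂ previous)) =
  (- + 1 , 0ℤ) , inj₂ (inj₁ refl) , cong₂ _,_ (previous-coordinate previous) (same-coordinate same)

down : ℤ²
down = 0ℤ , - + 1

down-unit : Unit down
down-unit = inj₂ (inj₂ (inj₂ refl))

-- A 1-perfect code T of Γ inside the colour class c cannot dominate a bottom-row vertex w
-- whose missing downward neighbour would have colour c: w itself is not in T (its colour
-- differs by the non-zero colour of down), and a neighbour of w in T would be w + down.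
bottom-row-undominated : ∀ {m n} c (T : Pred (ΓVtx m n)) → PerfectCode ΓAdj T →
  (∀ x → T x → ColourClass (suc m) (suc n) c x) →
  (i : Fin (suc m)) → ¬ (φ (lift {suc m} {suc n} (i , fzero)) + φ down ≋ c)
bottom-row-undominated {m} {n} c T (_ , dominating) T⊆c i below≋c =
  let (u , (u∈T , adj) , _) = dominating w w∉T
      (e , unit , lift-u≡) = grid-step w u adj
      e≡down = unit-injective unit down-unit (+-cancelˡ (φ (lift w)) (begin
        φ (lift w) + φ e     ≡⟨ φ-+ (lift w) e ⟨
        φ (lift w +² e)      ≡⟨ cong φ lift-u≡ ⟨
        φ (lift u)           ≈⟨ T⊆c u u∈T ⟩
        c                    ≈⟨ ≋-sym below≋c ⟩
        φ (lift w) + φ down  ∎))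
  in below-bottom (cong proj₂ (trans lift-u≡ (cong (lift w +²_) e≡down)))
  where
  open ≋-Reasoning
  w : ΓVtx m n
  w = i , fzero
  w∉T : ¬ T w
  w∉T w∈T = unit-colour-nonzero down-unit (≋-sym (+-cancelˡ (φ (lift w)) (begin
    φ (lift w) + 0ℤ      ≡⟨ ℤ.+-identityʳ _ ⟩
    φ (lift w)           ≈⟨ T⊆c w w∈T ⟩
    c                    ≈⟨ ≋-sym below≋c ⟩
    φ (lift w) + φ down  ∎)))
  below-bottom : ∀ {y} → + y ≢ - + 1
  below-bottom ()

bottom-vertex : ∀ {m} n → 4 ≤ m → ∀ c →
                Σ (Fin (suc m)) λ i → φ (lift {suc m} {suc n} (i , fzero)) + φ down ≋ c
bottom-vertex n 4≤m c = i , (begin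
  + toℕ i + + 2 * 0ℤ + φ down       ≡⟨ cong (_+ φ down) φ-lift ⟩
  + residue (c - φ down) + φ down   ≈⟨ +-congʳ (φ down) (≋-sym (≋-residue (c - φ down))) ⟩
  (c - φ down) + φ down             ≡⟨ cancel c (φ down) ⟩
  c                                 ∎)
  where
  open ≋-Reasoning
  r<1+m : residue (c - φ down) < suc _
  r<1+m = ℕ.≤-trans (n%ℕd<d (c - φ down) 5) (s≤s 4≤m)
  i = fromℕ< r<1+m
  φ-lift : + toℕ i + + 2 * 0ℤ ≡ + residue (c - φ down)
  φ-lift = trans (ℤ.+-identityʳ (+ toℕ i)) (cong +_ (Fin.toℕ-fromℕ< r<1+m))
  cancel : ∀ a b → (a - b) + b ≡ a
  cancel = solve-∀

grid-code-not-in-colour-class : ∀ {m n} → 4 ≤ m → ∀ c (T : Pred (ΓVtx m n)) → PerfectCode ΓAdj T →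
                                ¬ (∀ x → T x → ColourClass (suc m) (suc n) c x)
grid-code-not-in-colour-class {n = n} 4≤m c T code T⊆c =
  let (i , below≋c) = bottom-vertex n 4≤m c in bottom-row-undominated c T code T⊆c i below≋c

-- Reduction mod m changes a number by a multiple of m, hence by a multiple of 5 if 5 ∣ m.
reduce-≋ : ∀ m .{{_ : NonZero m}} → 5 ∣ m → ∀ z → + toℕ (reduce m z) ≋ z
reduce-≋ m 5∣m z = begin
  + toℕ (reduce m z)               ≡⟨ cong +_ (Fin.toℕ-fromℕ< _) ⟩
  + (z %ℕ m)                       ≈⟨ ≋-sym (+-multiple (∣n⇒∣m*n (z /ℕ m) (∣ᵤ⇒∣ 5∣m))) ⟩
  + (z %ℕ m) + (z /ℕ m) * + m      ≡⟨ a≡a%ℕn+[a/ℕn]*n z m ⟨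
  z                                ∎
  where open ≋-Reasoning

reduce-lift : ∀ m .{{_ : NonZero m}} (i : Fin m) → reduce m (+ toℕ i) ≡ i
reduce-lift m i = Fin.toℕ-injective (trans (Fin.toℕ-fromℕ< _) (m<n⇒m%n≡m (Fin.toℕ<n i)))

reduce-periodic : ∀ m .{{_ : NonZero m}} x k → reduce m (+ (x ℕ.+ k ℕ.* m)) ≡ reduce m (+ x)
reduce-periodic m x k = Fin.toℕ-injective (begin
  toℕ (reduce m (+ (x ℕ.+ k ℕ.* m)))  ≡⟨ Fin.toℕ-fromℕ< _ ⟩
  (x ℕ.+ k ℕ.* m) % m                 ≡⟨ [m+kn]%n≡m%n x k m ⟩
  x % m                               ≡⟨ Fin.toℕ-fromℕ< _ ⟨
  toℕ (reduce m (+ x))                ∎)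
  where open ≡-Reasoning

inverse-via-residue : ∀ m k r → m % 5 ≡ r → residue (+ 1 + + k * + r) ≡ 0 → + (1 ℕ.+ k ℕ.* m) ≋ 0ℤ
inverse-via-residue m k r m%5≡r vanishes = begin
  + (1 ℕ.+ k ℕ.* m)  ≡⟨ trans (ℤ.pos-+ 1 (k ℕ.* m)) (cong (_+_ (+ 1)) (ℤ.pos-* k m)) ⟩
  + 1 + + k * + m    ≈⟨ +-congˡ (+ 1) (*-congˡ (+ k) (≋-trans (≋-residue (+ m)) (≋-reflexive (cong +_ m%5≡r)))) ⟩
  + 1 + + k * + r    ≈⟨ residue-injective vanishes ⟩
  0ℤ                 ∎
  where open ≋-Reasoning

invertible-mod-5 : ∀ m → ¬ 5 ∣ m → Σ ℕ λ k → + (1 ℕ.+ k ℕ.* m) ≋ 0ℤ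
invertible-mod-5 m 5∤m with m % 5 in m%5≡r | m%n<n m 5
... | 0 | _ = contradiction (m%n≡0⇒n∣m m 5 m%5≡r) 5∤m
... | 1 | _ = 4 , inverse-via-residue m 4 1 m%5≡r refl
... | 2 | _ = 2 , inverse-via-residue m 2 2 m%5≡r refl
... | 3 | _ = 3 , inverse-via-residue m 3 3 m%5≡r refl
... | 4 | _ = 1 , inverse-via-residue m 1 4 m%5≡r refl
... | suc (suc (suc (suc (suc _)))) | s≤s (s≤s (s≤s (s≤s (s≤s ()))))

module Torus (m n : ℕ) .{{_ : NonZero m}} .{{_ : NonZero n}} where

  ρ-lift : ∀ v → ρ m n (lift v) ≡ v
  ρ-lift (i , j) = cong₂ _,_ (reduce-lift m i) (reduce-lift n j)

  origin : Vtx m n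
  origin = ρ m n (0ℤ , 0ℤ)

  lift-origin : lift origin ≡ (0ℤ , 0ℤ)
  lift-origin = cong₂ _,_ (lift-zero m) (lift-zero n)
    where lift-zero : ∀ k .{{_ : NonZero k}} → + toℕ (reduce k 0ℤ) ≡ 0ℤ
          lift-zero k = cong +_ (trans (Fin.toℕ-fromℕ< _) (m<n⇒m%n≡m (ℕ.>-nonZero⁻¹ k)))

  -- if a lattice point x reduces to the same vertex as a unit step e, then the vertices
  -- ρ(0,0) and ρ(x) of ρ(L) are adjacent, so ρ(L) is not independent
  ρL-not-independent : ∀ x e → InL x → Unit e → ρ m n x ≡ ρ m n e →
                       ¬ (∀ u v → ρL m n u → ρL m n v → ¬ TorusAdj m n u v)
  ρL-not-independent x e x∈L unit ρx≡ρe independent =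
    independent origin (ρ m n x) ((0ℤ , 0ℤ) , (0ℤ , 0ℤ , refl) , refl) (x , x∈L , refl)
      (e , unit , trans (cong (λ y → ρ m n (y +² e)) lift-origin) (trans (cong (ρ m n) (+²-identityˡ e)) (sym ρx≡ρe)))

  -- necessity: in a partition as in the theorem S⁰ = ρ(L) is a code, so 5 ∣ m and 5 ∣ n,
  -- since otherwise the point (1 + k·m, 0) or (0, 1 + k·n) of L reduces to a unit step
  necessary : (Σ (Fin 5 → Pred (Vtx m n)) λ S → IsTranslatePartition m n S) → 5 ∣ m × 5 ∣ n
  necessary (_ , _ , _ , perfect , S₀≐ρL , _) =
    decidable-stable (5 ∣? m) 5∤m-impossible , decidable-stable (5 ∣? n) 5∤n-impossible
    where
    open ≋-Reasoning
    independent : ∀ u v → ρL m n u → ρL m n v → ¬ TorusAdj m n u v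
    independent = proj₁ (PerfectCode-resp-≐ (λ v → ⇔-sym (S₀≐ρL v)) (perfect fzero))

    5∤m-impossible : ¬ ¬ 5 ∣ m
    5∤m-impossible 5∤m = ρL-not-independent x (+ 1 , 0ℤ) x∈L (inj₁ refl)
      (cong₂ _,_ (reduce-periodic m 1 k) refl) independent
      where
      k = proj₁ (invertible-mod-5 m 5∤m)
      x = + (1 ℕ.+ k ℕ.* m) , 0ℤ
      x∈L : InL x
      x∈L = Equivalence.from (InL⇔φ≋0 x) (begin
        + (1 ℕ.+ k ℕ.* m) + + 2 * 0ℤ  ≡⟨ ℤ.+-identityʳ _ ⟩
        + (1 ℕ.+ k ℕ.* m)             ≈⟨ proj₂ (invertible-mod-5 m 5∤m) ⟩
        0ℤ                            ∎)

    5∤n-impossible : ¬ ¬ 5 ∣ n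
    5∤n-impossible 5∤n = ρL-not-independent x (0ℤ , + 1) x∈L (inj₂ (inj₂ (inj₁ refl)))
      (cong₂ _,_ refl (reduce-periodic n 1 k)) independent
      where
      k = proj₁ (invertible-mod-5 n 5∤n)
      x = 0ℤ , + (1 ℕ.+ k ℕ.* n)
      x∈L : InL x
      x∈L = Equivalence.from (InL⇔φ≋0 x) (begin
        0ℤ + + 2 * + (1 ℕ.+ k ℕ.* n)  ≡⟨ ℤ.+-identityˡ _ ⟩
        + 2 * + (1 ℕ.+ k ℕ.* n)       ≈⟨ *-congˡ (+ 2) (proj₂ (invertible-mod-5 n 5∤n)) ⟩
        0ℤ                            ∎)

  module Divisible (5∣m : 5 ∣ m) (5∣n : 5 ∣ n) where

    colour-ρ : ∀ x → φ (lift (ρ m n x)) ≋ φ x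
    colour-ρ (a , b) = +-cong (reduce-≋ m 5∣m a) (*-congˡ (+ 2) (reduce-≋ n 5∣n b))

    colour-step : ∀ (v : Vtx m n) e → φ (lift (ρ m n (lift v +² e))) ≋ φ (lift v) + φ e
    colour-step v e = ≋-trans (colour-ρ (lift v +² e)) (≋-reflexive (φ-+ (lift v) e))

    adj-colour : ∀ {v u : Vtx m n} (adj : TorusAdj m n v u) → φ (lift u) ≋ φ (lift v) + φ (proj₁ adj)
    adj-colour {v} (e , _ , refl) = colour-step v e

    translate≐colour-class : ∀ t → TranslateρL m n t ≐ ColourClass m n (φ t)
    translate≐colour-class t v = mk⇔ (to v) (from v)
      where
      open ≋-Reasoning
      to : ∀ v → TranslateρL m n t v → ColourClass m n (φ t) v
      to _ (x , x∈L , refl) = begin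
        φ (lift (ρ m n (x +² t)))  ≈⟨ colour-ρ (x +² t) ⟩
        φ (x +² t)                 ≡⟨ φ-+ x t ⟩
        φ x + φ t                  ≈⟨ +-congʳ (φ t) (Equivalence.to (InL⇔φ≋0 x) x∈L) ⟩
        0ℤ + φ t                   ≡⟨ ℤ.+-identityˡ (φ t) ⟩
        φ t                        ∎
      from : ∀ v → ColourClass m n (φ t) v → TranslateρL m n t v
      from v φv≋φt = x , Equivalence.from (InL⇔φ≋0 x) φx≋0 , trans (cong (ρ m n) x+t≡v) (ρ-lift v)
        where
        x : ℤ²
        x = proj₁ (lift v) - proj₁ t , proj₂ (lift v) - proj₂ t
        x+t≡v : x +² t ≡ lift v
        x+t≡v = cong₂ _,_ (cancel (proj₁ (lift v)) (proj₁ t)) (cancel (proj₂ (lift v)) (proj₂ t))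
          where cancel : ∀ a b → (a - b) + b ≡ a
                cancel = solve-∀
        φx≋0 : φ x ≋ 0ℤ
        φx≋0 = +-cancelˡ (φ t) (begin
          φ t + φ x   ≡⟨ trans (ℤ.+-comm (φ t) (φ x)) (sym (φ-+ x t)) ⟩
          φ (x +² t)  ≡⟨ cong φ x+t≡v ⟩
          φ (lift v)  ≈⟨ φv≋φt ⟩
          φ t         ≡⟨ ℤ.+-identityʳ (φ t) ⟨
          φ t + 0ℤ    ∎)

    -- every colour class is a 1-perfect code of the torus: a unit step never preserves the
    -- colour, and from a vertex outside the class exactly one unit step enters it
    colour-class-perfect : ∀ c → PerfectCode (TorusAdj m n) (ColourClass m n c)
    colour-class-perfect c = independent , dominating
      where
      open ≋-Reasoning

      gap-closes : ∀ a → c ≡ a + (c - a)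
      gap-closes a = closes a c
        where closes : ∀ a c → c ≡ a + (c - a)
              closes = solve-∀

      independent : ∀ u v → ColourClass m n c u → ColourClass m n c v → ¬ TorusAdj m n u v
      independent u v φu≋c φv≋c adj@(e , unit , _) =
        unit-colour-nonzero unit (≋-sym (+-cancelˡ (φ (lift u)) (begin
          φ (lift u) + 0ℤ   ≡⟨ ℤ.+-identityʳ _ ⟩
          φ (lift u)        ≈⟨ ≋-trans φu≋c (≋-sym φv≋c) ⟩
          φ (lift v)        ≈⟨ adj-colour adj ⟩
          φ (lift u) + φ e  ∎)))

      unique-step : ∀ v e → Unit e → φ (lift v) + φ e ≋ c →
                    ∀ u′ → ColourClass m n c u′ → TorusAdj m n v u′ → u′ ≡ ρ m n (lift v +² e)
      unique-step v e unit step≋c u′ φu′≋c adj@(e′ , unit′ , refl) =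
        cong (λ s → ρ m n (lift v +² s)) (unit-injective unit′ unit (+-cancelˡ (φ (lift v)) (begin
          φ (lift v) + φ e′  ≈⟨ ≋-sym (adj-colour adj) ⟩
          φ (lift u′)        ≈⟨ φu′≋c ⟩
          c                  ≈⟨ ≋-sym step≋c ⟩
          φ (lift v) + φ e   ∎)))

      -- the step needed is the one whose colour has the residue of the gap c − φ(v)
      dominating : ∀ v → ¬ ColourClass m n c v →
                   Σ (Vtx m n) λ u → (ColourClass m n c u × TorusAdj m n v u) ×
                                     (∀ u′ → ColourClass m n c u′ → TorusAdj m n v u′ → u′ ≡ u)
      dominating v v∉c with residue (c - φ (lift v)) | ≋-residue (c - φ (lift v)) | n%ℕd<d (c - φ (lift v)) 5
      ... | 0 | gap≋0 | _ = contradiction (≋-sym (begin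
        c                              ≡⟨ gap-closes (φ (lift v)) ⟩
        φ (lift v) + (c - φ (lift v))  ≈⟨ +-congˡ (φ (lift v)) gap≋0 ⟩
        φ (lift v) + 0ℤ                ≡⟨ ℤ.+-identityʳ _ ⟩
        φ (lift v)                     ∎)) v∉c
      ... | suc r | gap≋r | r<5 =
        ρ m n (lift v +² e) , (u≋c , e , unit , refl) , unique-step v e unit step≋c
        where
        e = direction (suc r)
        unit = proj₁ (direction-unit (suc r) (s≤s z≤n) r<5)
        step≋c : φ (lift v) + φ e ≋ c
        step≋c = begin
          φ (lift v) + φ e               ≈⟨ +-congˡ (φ (lift v)) (≋-trans (proj₂ (direction-unit (suc r) (s≤s z≤n) r<5))
                                                                          (≋-sym gap≋r)) ⟩
          φ (lift v) + (c - φ (lift v))  ≡⟨ gap-closes (φ (lift v)) ⟨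
          c                              ∎
        u≋c : ColourClass m n c (ρ m n (lift v +² e))
        u≋c = ≋-trans (colour-step v e) step≋c

    shift : Fin 5 → ℤ²
    shift i = + toℕ i , 0ℤ

    shift≐colour-class : ∀ i → TranslateρL m n (shift i) ≐ ColourClass m n (+ toℕ i)
    shift≐colour-class i = subst (λ c → TranslateρL m n (shift i) ≐ ColourClass m n c)
                                 (ℤ.+-identityʳ (+ toℕ i)) (translate≐colour-class (shift i))

    shift-partition : IsTranslatePartition m n (λ i → TranslateρL m n (shift i))
    shift-partition = cover , disjoint , perfect , zeroth , λ i → shift i , λ _ → ⇔-refl
      where
      open ≋-Reasoning

      cover : ∀ v → Σ (Fin 5) λ i → TranslateρL m n (shift i) v
      cover v = i , Equivalence.from (shift≐colour-class i v) (begin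
        φ (lift v)              ≈⟨ ≋-residue (φ (lift v)) ⟩
        + residue (φ (lift v))  ≡⟨ cong +_ (Fin.toℕ-fromℕ< _) ⟨
        + toℕ i                 ∎)
        where i = fromℕ< (n%ℕd<d (φ (lift v)) 5)

      disjoint : ∀ v i j → TranslateρL m n (shift i) v → TranslateρL m n (shift j) v → i ≡ j
      disjoint v i j v∈i v∈j = Fin.toℕ-injective (≋-below-d (Fin.toℕ<n i) (Fin.toℕ<n j)
        (≋-trans (≋-sym (Equivalence.to (shift≐colour-class i v) v∈i)) (Equivalence.to (shift≐colour-class j v) v∈j)))

      perfect : ∀ i → PerfectCode (TorusAdj m n) (TranslateρL m n (shift i))
      perfect i = PerfectCode-resp-≐ (shift≐colour-class i) (colour-class-perfect (+ toℕ i))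

      zeroth : TranslateρL m n (shift fzero) ≐ ρL m n
      zeroth v = mk⇔ (λ (x , x∈L , eq) → x , x∈L , trans (cong (ρ m n) (sym (+²-identityʳ x))) eq)
                     (λ (x , x∈L , eq) → x , x∈L , trans (cong (ρ m n) (+²-identityʳ x)) eq)

    -- a set equal to a colour class has mn/5 vertices and is not the π-image of a
    -- 1-perfect code of Γ (as 5 ∣ m and m ≠ 0, Γ has at least 5 columns)
    colour-class-properties : ∀ {P} c → P ≐ ColourClass m n c →
      HasSize P (m ℕ.* n / 5) × ¬ (Σ (Pred (ΓVtx m n)) λ T → PerfectCode ΓAdj T × (P ≐ πImage m n T))
    colour-class-properties c P≐c =
      HasSize-resp-≐ P≐c (colour-class-size m n 5∣m c) ,
      λ (T , code , P≐πT) → grid-code-not-in-colour-class (ℕ.<⇒≤ (∣⇒≤ 5∣m)) c T code λ x x∈T →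
        ≋-trans (≋-sym (colour-ρ (lift x)))
                (Equivalence.to (P≐c (π m n x)) (Equivalence.from (P≐πT (π m n x)) (x , x∈T , refl)))

theorem7 : (m n : ℕ) → .{{_ : NonZero m}} → .{{_ : NonZero n}} → 3 ≤ m → 3 ≤ n →
    ((Σ (Fin 5 → Pred (Vtx m n)) λ S → IsTranslatePartition m n S) ⇔ (5 ∣ m × 5 ∣ n)) ×
    (5 ∣ m → 5 ∣ n → (S : Fin 5 → Pred (Vtx m n)) → IsTranslatePartition m n S →
      (i : Fin 5) →
        HasSize (S i) ((m ℕ.* n) / 5) ×
        ¬ (Σ (Pred (ΓVtx m n)) λ T → PerfectCode ΓAdj T × (S i ≐ πImage m n T)))
theorem7 m n _ _ =
  mk⇔ necessary (λ (5∣m , 5∣n) → _ , Divisible.shift-partition 5∣m 5∣n) ,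
  λ 5∣m 5∣n S (_ , _ , _ , _ , translates) i →
    let (t , Sᵢ≐translate) = translates i
        open Divisible 5∣m 5∣n
    in colour-class-properties (φ t) (λ v → ⇔-trans (Sᵢ≐translate v) (translate≐colour-class t v))
  where open Torus m n
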